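{- Let $a>1$ be an integer and let $n$ be an odd composite number with $\gcd(n,a)=1$ and prime factorization $n=p_1^{l_1}\cdots p_k^{l_k}$. Then $n$ is an overpseudoprime to base $a$ if and only if for every vector of integers $(i_1,\ldots,i_k)$ with $0\le i_j\le l_j$ for all $j$ and not all $i_j=0$, we have $h_a(n)=h_a(p_1^{i_1}\cdots p_k^{i_k})$.
   Context: For an integer $a>1$ and an integer $m>1$ with $\gcd(m,a)=1$, $h_a(m)$ denotes the multiplicative order of $a$ modulo $m$. The cyclotomic cosets of $a$ modulo $m$ are the orbits of $\{1,2,\ldots,m-1\}$ under $x\mapsto ax\bmod m$; $r_a(m)$ denotes their number. An odd composite number $n$ with $\gcd(n,a)=1$ is called an overpseudoprime to base $a$ if $n=r_a(n)h_a(n)+1$. -}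

module Defs where

open import Data.Nat using (ℕ; zero; suc; _+_; _*_; _^_; _≤_; _<_)
open import Data.Nat.DivMod using (_%_)
open import Data.Nat.GCD using (gcd)
open import Data.Nat.Primality using (Composite)
open import Data.Bool using (Bool; true; false; if_then_else_)
open import Relation.Nullary.Decidable using (⌊_⌋)
open import Data.Nat.Properties using (_≟_; _≤?_)
open import Data.Vec using (Vec; foldr′; zipWith)
open import Data.Product using (_×_)
open import Relation.Binary.PropositionalEquality using (_≡_)

-- Multiplicative order h_a(m): least k ≥ 1 with a^k ≡ 1 (mod m).
-- Searched in the range 1 ≤ k ≤ m (which contains it whenever gcd(a,m) = 1,
-- since the order is at most φ(m) ≤ m); returns 0 if no such k is found
-- (or if m = 0).
ordSearch : (a m' : ℕ) → (fuel k : ℕ) → ℕ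
ordSearch a m' zero    k = 0
ordSearch a m' (suc f) k =
  if ⌊ ((a ^ k) % suc m') ≟ (1 % suc m') ⌋ then k else ordSearch a m' f (suc k)

h : ℕ → ℕ → ℕ
h a zero     = 0
h a (suc m') = ordSearch a m' (suc m') 1

countRange : (ℕ → Bool) → (lo cnt : ℕ) → ℕ
countRange p lo zero      = 0
countRange p lo (suc c)   = (if p lo then 1 else 0) + countRange p (suc lo) c

-- x is the least element of its cyclotomic coset {a^j x mod m : j ≥ 0}
-- (the orbit of x under x ↦ a x mod m).  The exponents j < m already
-- exhaust the orbit, since the orbit has at most m elements.
allBelow : (ℕ → Bool) → ℕ → Bool
allBelow p zero    = true
allBelow p (suc j) = if p j then allBelow p j else false

isCosetMin : (a m' x : ℕ) → Bool
isCosetMin a m' x = allBelow (λ j → ⌊ x ≤? ((a ^ j * x) % suc m') ⌋) (suc m')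

-- r_a(m): number of cyclotomic cosets of a modulo m, i.e. number of orbits of
-- {1, ..., m-1} under x ↦ a x mod m, counted via their least elements.
r : ℕ → ℕ → ℕ
r a zero     = 0
r a (suc m') = countRange (isCosetMin a m') 1 m'

Odd : ℕ → Set
Odd n = n % 2 ≡ 1

Overpseudoprime : ℕ → ℕ → Set
Overpseudoprime a n =
  Odd n × Composite n × gcd n a ≡ 1 × n ≡ r a n * h a n + 1

prodPow : ∀ {k} → Vec ℕ k → Vec ℕ k → ℕ
prodPow ps es = foldr′ _*_ 1 (zipWith _^_ ps es)

-- The powers of a act on the nonzero residues modulo n; the orbits are the cyclotomic
-- cosets, each of size at most h = h_a(n).  Counting the pairs (coset leader x, j < h) by
-- the residue a^j x they produce gives r_a(n) h ≥ n - 1, with equality iff every residue is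
-- produced exactly once, i.e. iff a^j x ≢ x (mod n) for all 0 < j < h and 0 < x < n.  Such
-- a fixed point means n ∣ (a^j - 1) x.  If a divisor d > 1 of n had h_a(d) < h, the cofactor
-- n / d would be fixed by a^(h_a(d)); conversely a fixed point makes some prime p ∣ n divide
-- a^j - 1, so that h_a(p) ≤ j < h.
module Submission where

open import Defs
open import Data.Bool using (Bool; true; false; T; if_then_else_)
open import Data.Empty using (⊥; ⊥-elim)
open import Data.Fin as Fin using (Fin; toℕ; fromℕ<)
import Data.Fin.Properties as Fin
open import Data.List using ([]; _∷_)
open import Data.List.Relation.Unary.All using (_∷_)
open import Data.Nat
open import Data.Nat.Coprimality using (Coprime; coprime-divisor; gcd≡1⇒coprime)
open import Data.Nat.DivMod
open import Data.Nat.Divisibility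
open import Data.Nat.GCD using (gcd; gcd[m,n]∣m; gcd[m,n]∣n)
open import Data.Nat.ListAction using (product)
open import Data.Nat.Primality
  using (Prime; Composite; euclidsLemma; prime⇒nonZero; prime⇒nonTrivial; prime⇒irreducible)
open import Data.Nat.Primality.Factorisation using (PrimeFactorisation; factorise)
open import Data.Nat.Properties
open import Algebra.Properties.CommutativeSemigroup +-commutativeSemigroup
  using () renaming (interchange to +-interchange)
open import Data.Product using (_×_; _,_; ∃; ∃₂; proj₁; proj₂)
open import Data.Sum using (_⊎_; inj₁; inj₂; [_,_]′)
open import Data.Vec using (Vec; []; _∷_; lookup; replicate; _[_]≔_)
open import Data.Vec.Properties using (lookup∘update; lookup∘update′; lookup-replicate)
open import Function.Base using (_∘_)
open import Function.Bundles using (_⇔_; mk⇔; Equivalence)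
open import Relation.Binary.Definitions using (tri<; tri≈; tri>)
open import Relation.Binary.PropositionalEquality
open import Relation.Nullary using (¬_; yes; no; contradiction)
open import Relation.Nullary.Decidable using (toWitness; fromWitness; dec-false)

open Equivalence using (to; from)

[m+n]%d≡m%d⇒d∣n : ∀ m n d .{{_ : NonZero d}} → (m + n) % d ≡ m % d → d ∣ n
[m+n]%d≡m%d⇒d∣n m n d eq = ∣m+n∣m⇒∣n (divides ((m + n) / d) shift) (n∣m*n (m / d))
  where
  open ≡-Reasoning
  shift : m / d * d + n ≡ (m + n) / d * d
  shift = +-cancelˡ-≡ (m % d) _ _ (begin
    m % d + (m / d * d + n)        ≡⟨ +-assoc (m % d) _ n ⟨
    m % d + m / d * d + n          ≡⟨ cong (_+ n) (m≡m%n+[m/n]*n m d) ⟨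
    m + n                          ≡⟨ m≡m%n+[m/n]*n (m + n) d ⟩
    (m + n) % d + (m + n) / d * d  ≡⟨ cong (_+ (m + n) / d * d) eq ⟩
    m % d + (m + n) / d * d        ∎)

[b*x]%d≡x%d⇔d∣[b∸1]*x : ∀ {b} x d .{{_ : NonZero d}} → 1 ≤ b →
                        b * x % d ≡ x % d ⇔ d ∣ (b ∸ 1) * x
[b*x]%d≡x%d⇔d∣[b∸1]*x {b} x d 1≤b = mk⇔
  (λ fixed → [m+n]%d≡m%d⇒d∣n x _ d (trans (cong (_% d) split) fixed))
  (λ d∣ → trans (cong (_% d) (sym split)) (%-remove-+ʳ x d∣))
  where
  split : x + (b ∸ 1) * x ≡ b * x
  split = cong (_* x) (m+[n∸m]≡n 1≤b)

b%d≡1%d⇔d∣b∸1 : ∀ {b} d .{{_ : NonZero d}} → 1 ≤ b → b % d ≡ 1 % d ⇔ d ∣ b ∸ 1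
b%d≡1%d⇔d∣b∸1 {b} d 1≤b = mk⇔
  (λ b≡1 → [m+n]%d≡m%d⇒d∣n 1 _ d (trans (cong (_% d) split) b≡1))
  (λ d∣ → trans (cong (_% d) (sym split)) (%-remove-+ʳ 1 d∣))
  where
  split : 1 + (b ∸ 1) ≡ b
  split = m+[n∸m]≡n 1≤b

∣-%-cong : ∀ {d n x y} .{{_ : NonZero d}} .{{_ : NonZero n}} →
           d ∣ n → x % n ≡ y % n → x % d ≡ y % d
∣-%-cong {d} {n} {x} {y} d∣n eq = begin
  x % d      ≡⟨ m∣n⇒o%n%m≡o%m d n x d∣n ⟨
  x % n % d  ≡⟨ cong (_% d) eq ⟩
  y % n % d  ≡⟨ m∣n⇒o%n%m≡o%m d n y d∣n ⟩
  y % d      ∎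
  where open ≡-Reasoning

coprime-∣ˡ : ∀ {d m n} → d ∣ m → Coprime m n → Coprime d n
coprime-∣ˡ d∣m m⊥n (e∣d , e∣n) = m⊥n (∣-trans e∣d d∣m , e∣n)

coprime-* : ∀ {d m n} → Coprime d m → Coprime d n → Coprime d (m * n)
coprime-* d⊥m d⊥n (e∣d , e∣mn) = d⊥n (e∣d , coprime-divisor (coprime-∣ˡ e∣d d⊥m) e∣mn)

coprime-^ : ∀ {d m} i → Coprime d m → Coprime d (m ^ i)
coprime-^ zero    d⊥m (_ , e∣1) = ∣1⇒≡1 e∣1
coprime-^ (suc i) d⊥m = coprime-* d⊥m (coprime-^ i d⊥m)

coprime-*-cancelˡ-% : ∀ {d c u v} .{{_ : NonZero d}} → Coprime d c →
                      c * u % d ≡ c * v % d → u % d ≡ v % d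
coprime-*-cancelˡ-% {d} {c} {u} {v} d⊥c eq =
  [ (λ u≤v → cancel u≤v eq) , (λ v≤u → sym (cancel v≤u (sym eq))) ]′ (≤-total u v)
  where
  cancel : ∀ {u v} → u ≤ v → c * u % d ≡ c * v % d → u % d ≡ v % d
  cancel {u} {v} u≤v eq = trans (sym (%-remove-+ʳ u d∣v∸u)) (cong (_% d) (m+[n∸m]≡n u≤v))
    where
    split : c * u + c * (v ∸ u) ≡ c * v
    split = trans (sym (*-distribˡ-+ c u (v ∸ u))) (cong (c *_) (m+[n∸m]≡n u≤v))
    d∣v∸u : d ∣ v ∸ u
    d∣v∸u = coprime-divisor d⊥c ([m+n]%d≡m%d⇒d∣n (c * u) _ d (trans (cong (_% d) split) (sym eq)))

common-prime-divisor : ∀ {m n} .{{_ : NonZero m}} → ¬ Coprime m n →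
                       ∃ λ p → Prime p × p ∣ m × p ∣ n
common-prime-divisor {m} {n} ¬m⊥n = prime-of (factorise g)
  where
  g : ℕ
  g = gcd m n
  instance
    _ : NonZero g
    _ = ≢-nonZero λ g≡0 → ≢-nonZero⁻¹ m (0∣⇒≡0 (subst (_∣ m) g≡0 (gcd[m,n]∣m m n)))
  prime-of : PrimeFactorisation g → ∃ λ p → Prime p × p ∣ m × p ∣ n
  prime-of record { factors = [] ; isFactorisation = g≡1 } = ⊥-elim (¬m⊥n (gcd≡1⇒coprime g≡1))
  prime-of record { factors = p ∷ ps ; isFactorisation = g≡p*ps ; factorsPrime = p-prime ∷ _ } =
    p , p-prime , ∣-trans p∣g (gcd[m,n]∣m m n) , ∣-trans p∣g (gcd[m,n]∣n m n)
    where
    p∣g : p ∣ g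
    p∣g = subst (p ∣_) (sym g≡p*ps) (m∣m*n (product ps))

pow≡1-within-modulus : ∀ a M .{{_ : NonZero M}} → Coprime M a →
                       ∃ λ w → 1 ≤ w × w ≤ M × a ^ w % M ≡ 1 % M
pow≡1-within-modulus a M M⊥a with Fin.pigeonhole (n<1+n M) residue
  where
  residue : Fin (suc M) → Fin M
  residue i = fromℕ< (m%n<n (a ^ toℕ i) M)
... | i , j , i<j , same =
  toℕ j ∸ toℕ i , m<n⇒0<n∸m i<j , ≤-trans (m∸n≤m (toℕ j) (toℕ i)) (≤-pred (Fin.toℕ<n j)) ,
  sym (coprime-*-cancelˡ-% (coprime-^ (toℕ i) M⊥a) (begin
    a ^ toℕ i * 1 % M                    ≡⟨ cong (_% M) (*-identityʳ (a ^ toℕ i)) ⟩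
    a ^ toℕ i % M                        ≡⟨ Fin.toℕ-fromℕ< _ ⟨
    toℕ (fromℕ< (m%n<n (a ^ toℕ i) M))   ≡⟨ cong toℕ same ⟩
    toℕ (fromℕ< (m%n<n (a ^ toℕ j) M))   ≡⟨ Fin.toℕ-fromℕ< _ ⟩
    a ^ toℕ j % M                        ≡⟨ cong (λ e → a ^ e % M) (m+[n∸m]≡n (<⇒≤ i<j)) ⟨
    a ^ (toℕ i + (toℕ j ∸ toℕ i)) % M    ≡⟨ cong (_% M) (^-distribˡ-+-* a (toℕ i) _) ⟩
    a ^ toℕ i * a ^ (toℕ j ∸ toℕ i) % M  ∎))
  where open ≡-Reasoning

record IsLeast (P : ℕ → Set) (k t : ℕ) : Set where
  field
    lowerBound : k ≤ t
    holds      : P t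
    least      : ∀ {v} → k ≤ v → P v → t ≤ v

open IsLeast

IsOrder : (a M : ℕ) .{{_ : NonZero M}} → ℕ → Set
IsOrder a M = IsLeast (λ v → a ^ v % M ≡ 1 % M) 1

ordSearch-least : ∀ a m' f k {w} → k ≤ w → w < k + f → a ^ w % suc m' ≡ 1 % suc m' →
                  IsLeast (λ v → a ^ v % suc m' ≡ 1 % suc m') k (ordSearch a m' f k)
ordSearch-least a m' zero k k≤w w<k+0 _ =
  contradiction k≤w (<⇒≱ (subst (_ <_) (+-identityʳ k) w<k+0))
ordSearch-least a m' (suc f) k {w} k≤w w<k+1+f a^w≡1 with a ^ k % suc m' ≟ 1 % suc m'
... | yes a^k≡1 = record { lowerBound = ≤-refl ; holds = a^k≡1 ; least = λ k≤v _ → k≤v }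
... | no  a^k≢1 = record
  { lowerBound = ≤-trans (n≤1+n k) (lowerBound rest)
  ; holds      = holds rest
  ; least      = λ k≤v a^v≡1 → least rest (≤∧≢⇒< k≤v λ { refl → a^k≢1 a^v≡1 }) a^v≡1
  }
  where
  rest : IsLeast (λ v → a ^ v % suc m' ≡ 1 % suc m') (suc k) (ordSearch a m' f (suc k))
  rest = ordSearch-least a m' f (suc k) (≤∧≢⇒< k≤w λ { refl → a^k≢1 a^w≡1 })
                         (subst (w <_) (+-suc k f) w<k+1+f) a^w≡1

h-isOrder : ∀ a M .{{_ : NonZero M}} → Coprime M a → IsOrder a M (h a M) × h a M ≤ M
h-isOrder a (suc m') M⊥a with pow≡1-within-modulus a (suc m') M⊥a
... | w , 1≤w , w≤M , a^w≡1 = order , ≤-trans (least order 1≤w a^w≡1) w≤M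
  where
  order : IsOrder a (suc m') (h a (suc m'))
  order = ordSearch-least a m' (suc m') 1 1≤w (s≤s w≤M) a^w≡1

prime>1 : ∀ {p} → Prime p → 1 < p
prime>1 {p} p-prime = nonTrivial⇒n>1 p {{prime⇒nonTrivial p-prime}}

prime∣^⇒≡ : ∀ {p q} l → Prime p → Prime q → p ∣ q ^ l → p ≡ q
prime∣^⇒≡ zero p-prime _ p∣1 = contradiction (∣1⇒≡1 p∣1) (>⇒≢ (prime>1 p-prime))
prime∣^⇒≡ {q = q} (suc l) p-prime q-prime p∣q^l+1 with euclidsLemma q (q ^ l) p-prime p∣q^l+1
... | inj₂ p∣q^l = prime∣^⇒≡ l p-prime q-prime p∣q^l
... | inj₁ p∣q with prime⇒irreducible q-prime p∣q
...   | inj₁ p≡1 = contradiction p≡1 (>⇒≢ (prime>1 p-prime))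
...   | inj₂ p≡q = p≡q

prime∣prodPow⇒≡ : ∀ {k p} (ps ls : Vec ℕ k) → (∀ j → Prime (lookup ps j)) → Prime p →
                  p ∣ prodPow ps ls → ∃ λ j → p ≡ lookup ps j
prime∣prodPow⇒≡ [] [] _ p-prime p∣1 = contradiction (∣1⇒≡1 p∣1) (>⇒≢ (prime>1 p-prime))
prime∣prodPow⇒≡ (q ∷ ps) (l ∷ ls) primes p-prime p∣
  with euclidsLemma (q ^ l) (prodPow ps ls) p-prime p∣
... | inj₁ p∣q^l = Fin.zero , prime∣^⇒≡ l p-prime (primes Fin.zero) p∣q^l
... | inj₂ p∣rest with prime∣prodPow⇒≡ ps ls (primes ∘ Fin.suc) p-prime p∣rest
...   | j , p≡ = Fin.suc j , p≡

prodPow-zeros : ∀ {k} (ps : Vec ℕ k) → prodPow ps (replicate k 0) ≡ 1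
prodPow-zeros []       = refl
prodPow-zeros (q ∷ ps) = trans (+-identityʳ _) (prodPow-zeros ps)

prodPow-unit : ∀ {k} (ps : Vec ℕ k) j → prodPow ps (replicate k 0 [ j ]≔ 1) ≡ lookup ps j
prodPow-unit (q ∷ ps) Fin.zero    =
  trans (cong (q * 1 *_) (prodPow-zeros ps)) (trans (*-identityʳ _) (*-identityʳ q))
prodPow-unit (q ∷ ps) (Fin.suc j) = trans (+-identityʳ _) (prodPow-unit ps j)

^-monoʳ-∣ : ∀ q {i l} → i ≤ l → q ^ i ∣ q ^ l
^-monoʳ-∣ q {i} {l} i≤l = subst (q ^ i ∣_) q^l≡ (m∣m*n (q ^ (l ∸ i)))
  where
  q^l≡ : q ^ i * q ^ (l ∸ i) ≡ q ^ l
  q^l≡ = trans (sym (^-distribˡ-+-* q i (l ∸ i))) (cong (q ^_) (m+[n∸m]≡n i≤l))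

prodPow-mono-∣ : ∀ {k} (ps is ls : Vec ℕ k) → (∀ j → lookup is j ≤ lookup ls j) →
                 prodPow ps is ∣ prodPow ps ls
prodPow-mono-∣ []       []       []       _     = ∣-refl
prodPow-mono-∣ (q ∷ ps) (i ∷ is) (l ∷ ls) is≤ls =
  *-pres-∣ (^-monoʳ-∣ q (is≤ls Fin.zero)) (prodPow-mono-∣ ps is ls (is≤ls ∘ Fin.suc))

prodPow-pos : ∀ {k} (ps is : Vec ℕ k) → (∀ j → Prime (lookup ps j)) → 1 ≤ prodPow ps is
prodPow-pos []       []       _      = ≤-refl
prodPow-pos (q ∷ ps) (i ∷ is) primes =
  *-mono-≤ (m^n>0 q {{prime⇒nonZero (primes Fin.zero)}} i) (prodPow-pos ps is (primes ∘ Fin.suc))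

prodPow>1 : ∀ {k} (ps is : Vec ℕ k) → (∀ j → Prime (lookup ps j)) →
            ∃ (λ j → lookup is j ≢ 0) → 1 < prodPow ps is
prodPow>1 (q ∷ ps) (zero ∷ is) _ (Fin.zero , i≢0) = contradiction refl i≢0
prodPow>1 (q ∷ ps) (suc i ∷ is) primes (Fin.zero , _) =
  *-mono-≤ (*-mono-≤ (prime>1 (primes Fin.zero)) (m^n>0 q {{prime⇒nonZero (primes Fin.zero)}} i))
           (prodPow-pos ps is (primes ∘ Fin.suc))
prodPow>1 (q ∷ ps) (i ∷ is) primes (Fin.suc j , i≢0) =
  *-mono-≤ (m^n>0 q {{prime⇒nonZero (primes Fin.zero)}} i)
           (prodPow>1 ps is (primes ∘ Fin.suc) (j , i≢0))

indicator : Bool → ℕ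
indicator b = if b then 1 else 0

indicator-T : ∀ {b} → T b → indicator b ≡ 1
indicator-T {true} _ = refl

indicator-*-pos : ∀ {b c} → 1 ≤ indicator b * indicator c → T b × T c
indicator-*-pos {true}  {true}  _ = _ , _
indicator-*-pos {true}  {false} ()
indicator-*-pos {false}         ()

∑ : (ℕ → ℕ) → (lo c : ℕ) → ℕ
∑ f lo zero    = 0
∑ f lo (suc c) = f lo + ∑ f (suc lo) c

Within : (lo c x : ℕ) → Set
Within lo c x = lo ≤ x × x < lo + c

within-empty : ∀ {lo x} → ¬ Within lo 0 x
within-empty {lo} (lo≤x , x<lo+0) = <⇒≱ (subst (_ <_) (+-identityʳ lo) x<lo+0) lo≤x

within-head : ∀ lo c → Within lo (suc c) lo
within-head lo c = ≤-refl , subst (lo <_) (sym (+-suc lo c)) (m≤m+n (suc lo) c)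

within-tail : ∀ {lo c x} → Within (suc lo) c x → Within lo (suc c) x
within-tail {lo} {c} {x} (lo<x , x<) = <⇒≤ lo<x , subst (x <_) (sym (+-suc lo c)) x<

within-split : ∀ {lo c x} → Within lo (suc c) x → x ≡ lo ⊎ Within (suc lo) c x
within-split {lo} {c} {x} (lo≤x , x<) with m≤n⇒m<n∨m≡n lo≤x
... | inj₂ refl = inj₁ refl
... | inj₁ lo<x = inj₂ (lo<x , subst (x <_) (+-suc lo c) x<)

countRange≡∑ : ∀ p lo c → countRange p lo c ≡ ∑ (indicator ∘ p) lo c
countRange≡∑ p lo zero    = refl
countRange≡∑ p lo (suc c) = cong (indicator (p lo) +_) (countRange≡∑ p (suc lo) c)

∑-cong : ∀ {f g lo} c → (∀ x → Within lo c x → f x ≡ g x) → ∑ f lo c ≡ ∑ g lo c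
∑-cong          zero    _   = refl
∑-cong {lo = lo} (suc c) f≡g =
  cong₂ _+_ (f≡g lo (within-head lo c)) (∑-cong c λ x x∈ → f≡g x (within-tail x∈))

∑-vanish : ∀ {f lo} c → (∀ x → Within lo c x → f x ≡ 0) → ∑ f lo c ≡ 0
∑-vanish          zero    _   = refl
∑-vanish {lo = lo} (suc c) f≡0 =
  cong₂ _+_ (f≡0 lo (within-head lo c)) (∑-vanish c λ x x∈ → f≡0 x (within-tail x∈))

∑-+ : ∀ f g lo c → ∑ (λ x → f x + g x) lo c ≡ ∑ f lo c + ∑ g lo c
∑-+ f g lo zero    = refl
∑-+ f g lo (suc c) =
  trans (cong (f lo + g lo +_) (∑-+ f g (suc lo) c)) (+-interchange (f lo) (g lo) _ _)

∑-swap : ∀ (F : ℕ → ℕ → ℕ) lo₁ c₁ lo₂ c₂ →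
         ∑ (λ x → ∑ (F x) lo₂ c₂) lo₁ c₁ ≡ ∑ (λ y → ∑ (λ x → F x y) lo₁ c₁) lo₂ c₂
∑-swap F lo₁ zero     lo₂ c₂ = sym (∑-vanish c₂ λ _ _ → refl)
∑-swap F lo₁ (suc c₁) lo₂ c₂ =
  trans (cong (∑ (F lo₁) lo₂ c₂ +_) (∑-swap F (suc lo₁) c₁ lo₂ c₂)) (sym (∑-+ (F lo₁) _ lo₂ c₂))

∑-*ˡ : ∀ k f lo c → ∑ (λ x → k * f x) lo c ≡ k * ∑ f lo c
∑-*ˡ k f lo zero    = sym (*-zeroʳ k)
∑-*ˡ k f lo (suc c) =
  trans (cong (k * f lo +_) (∑-*ˡ k f (suc lo) c)) (sym (*-distribˡ-+ k (f lo) _))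

∑-const : ∀ k lo c → ∑ (λ _ → k) lo c ≡ c * k
∑-const k lo zero    = refl
∑-const k lo (suc c) = cong (k +_) (∑-const k (suc lo) c)

∑-single : ∀ {f lo c v} → Within lo c v → (∀ x → Within lo c x → x ≢ v → f x ≡ 0) →
           ∑ f lo c ≡ f v
∑-single {c = zero} v∈ _ = contradiction v∈ within-empty
∑-single {f} {lo} {suc c} v∈ others with within-split v∈
... | inj₁ refl =
  trans (cong (f lo +_) (∑-vanish c λ x x∈ → others x (within-tail x∈) (>⇒≢ (proj₁ x∈))))
        (+-identityʳ (f lo))
... | inj₂ v∈′  = cong₂ _+_ (others lo (within-head lo c) (<⇒≢ (proj₁ v∈′)))
                            (∑-single v∈′ λ x x∈ → others x (within-tail x∈))

∑-≥term : ∀ {f lo c v} → Within lo c v → f v ≤ ∑ f lo c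
∑-≥term {c = zero} v∈ = contradiction v∈ within-empty
∑-≥term {f} {lo} {suc c} v∈ with within-split v∈
... | inj₁ refl = m≤m+n (f lo) _
... | inj₂ v∈′  = ≤-trans (∑-≥term v∈′) (m≤n+m _ (f lo))

∑-≥2 : ∀ {f lo c u v} → Within lo c u → Within lo c v → u ≢ v → 1 ≤ f u → 1 ≤ f v →
       2 ≤ ∑ f lo c
∑-≥2 {c = zero} u∈ _ _ _ _ = contradiction u∈ within-empty
∑-≥2 {f} {lo} {suc c} u∈ v∈ u≢v fu fv with within-split u∈ | within-split v∈
... | inj₁ refl | inj₁ refl = contradiction refl u≢v
... | inj₁ refl | inj₂ v∈′  = +-mono-≤ fu (≤-trans fv (∑-≥term v∈′))
... | inj₂ u∈′  | inj₁ refl = +-mono-≤ fv (≤-trans fu (∑-≥term u∈′))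
... | inj₂ u∈′  | inj₂ v∈′  = ≤-trans (∑-≥2 u∈′ v∈′ u≢v fu fv) (m≤n+m _ (f lo))

∑-≥count : ∀ {f lo} c → (∀ x → Within lo c x → 1 ≤ f x) → c ≤ ∑ f lo c
∑-≥count          zero    _   = z≤n
∑-≥count {lo = lo} (suc c) pos =
  +-mono-≤ (pos lo (within-head lo c)) (∑-≥count c λ x x∈ → pos x (within-tail x∈))

∑->count : ∀ {f lo c v} → (∀ x → Within lo c x → 1 ≤ f x) → Within lo c v → 2 ≤ f v →
           c < ∑ f lo c
∑->count {c = zero} _ v∈ _ = contradiction v∈ within-empty
∑->count {f} {lo} {suc c} pos v∈ fv≥2 with within-split v∈
... | inj₁ refl = +-mono-≤ fv≥2 (∑-≥count c λ x x∈ → pos x (within-tail x∈))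
... | inj₂ v∈′  =
  +-mono-≤ (pos lo (within-head lo c)) (∑->count (λ x x∈ → pos x (within-tail x∈)) v∈′ fv≥2)

allBelow-sound : ∀ p K → T (allBelow p K) → ∀ {j} → j < K → T (p j)
allBelow-sound p (suc K) all {j} j<1+K with p K in pK | m≤n⇒m<n∨m≡n (≤-pred j<1+K)
... | true | inj₁ j<K  = allBelow-sound p K all j<K
... | true | inj₂ refl = subst T (sym pK) _

allBelow-complete : ∀ p K → (∀ {j} → j < K → T (p j)) → T (allBelow p K)
allBelow-complete p zero    _   = _
allBelow-complete p (suc K) all with p K in pK
... | true  = allBelow-complete p K (all ∘ m<n⇒m<1+n)
... | false = subst T pK (all ≤-refl)

argmin : ∀ (f : ℕ → ℕ) K → ∃ λ i → i < suc K × (∀ {j} → j < suc K → f i ≤ f j)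
argmin f zero = 0 , z<s , λ { z<s → ≤-refl }
argmin f (suc K) with argmin f K
... | i , i<1+K , fi≤ with f i ≤? f (suc K)
...   | yes fi≤fK =
  i , m<n⇒m<1+n i<1+K , [ fi≤ , (λ { refl → fi≤fK }) ]′ ∘ m≤n⇒m<n∨m≡n ∘ ≤-pred
...   | no  fi≰fK =
  suc K , ≤-refl , [ ≤-trans (<⇒≤ (≰⇒> fi≰fK)) ∘ fi≤ , (λ { refl → ≤-refl }) ]′
                   ∘ m≤n⇒m<n∨m≡n ∘ ≤-pred

module Cosets (a m' H' : ℕ) (a^H≡1 : a ^ suc H' % suc m' ≡ 1 % suc m') (H≤n : suc H' ≤ suc m') where

  n H : ℕ
  n = suc m'
  H = suc H'

  act : ℕ → ℕ → ℕ
  act j x = a ^ j * x % n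

  act<n : ∀ t x → act t x < n
  act<n t x = m%n<n (a ^ t * x) n

  act-%ʳ : ∀ t x → act t (x % n) ≡ act t x
  act-%ʳ t x = begin
    a ^ t * (x % n) % n              ≡⟨ %-distribˡ-* (a ^ t) (x % n) n ⟩
    a ^ t % n * (x % n % n) % n      ≡⟨ cong (λ y → a ^ t % n * y % n) (m%n%n≡m%n x n) ⟩
    a ^ t % n * (x % n) % n          ≡⟨ %-distribˡ-* (a ^ t) x n ⟨
    a ^ t * x % n                    ∎
    where open ≡-Reasoning

  act-+ : ∀ s t x → act (s + t) x ≡ act s (act t x)
  act-+ s t x = begin
    a ^ (s + t) * x % n      ≡⟨ cong (λ y → y * x % n) (^-distribˡ-+-* a s t) ⟩
    a ^ s * a ^ t * x % n    ≡⟨ cong (_% n) (*-assoc (a ^ s) (a ^ t) x) ⟩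
    a ^ s * (a ^ t * x) % n  ≡⟨ act-%ʳ s (a ^ t * x) ⟨
    act s (act t x)          ∎
    where open ≡-Reasoning

  act-period : ∀ k x → act (k * H) x ≡ x % n
  act-period zero    x = cong (_% n) (*-identityˡ x)
  act-period (suc k) x = begin
    act (H + k * H) x          ≡⟨ act-+ H (k * H) x ⟩
    act H (act (k * H) x)      ≡⟨ cong (act H) (act-period k x) ⟩
    act H (x % n)              ≡⟨ act-%ʳ H x ⟩
    a ^ H * x % n              ≡⟨ %-distribˡ-* (a ^ H) x n ⟩
    a ^ H % n * (x % n) % n    ≡⟨ cong (λ y → y * (x % n) % n) a^H≡1 ⟩
    1 % n * (x % n) % n        ≡⟨ %-distribˡ-* 1 x n ⟨
    1 * x % n                  ≡⟨ cong (_% n) (*-identityˡ x) ⟩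
    x % n                      ∎
    where open ≡-Reasoning

  act-%-period : ∀ t x → act t x ≡ act (t % H) x
  act-%-period t x = begin
    act t x                              ≡⟨ cong (λ s → act s x) (m≡m%n+[m/n]*n t H) ⟩
    act (t % H + t / H * H) x            ≡⟨ act-+ (t % H) _ x ⟩
    act (t % H) (act (t / H * H) x)      ≡⟨ cong (act (t % H)) (act-period (t / H) x) ⟩
    act (t % H) (x % n)                  ≡⟨ act-%ʳ (t % H) x ⟩
    act (t % H) x                        ∎
    where open ≡-Reasoning

  act-inverse : ∀ t x → act (t * H') (act t x) ≡ x % n
  act-inverse t x = begin
    act (t * H') (act t x)  ≡⟨ act-+ (t * H') t x ⟨
    act (t * H' + t) x      ≡⟨ cong (λ s → act s x) (trans (+-comm (t * H') t) (sym (*-suc t H'))) ⟩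
    act (t * H) x           ≡⟨ act-period t x ⟩
    x % n                   ∎
    where open ≡-Reasoning

  act-injective : ∀ t {x y} → act t x ≡ act t y → x % n ≡ y % n
  act-injective t {x} {y} eq =
    trans (sym (act-inverse t x)) (trans (cong (act (t * H')) eq) (act-inverse t y))

  act-nonzero : ∀ t {x} → Within 1 m' x → 1 ≤ act t x
  act-nonzero t {x} (1≤x , x<n) = n≢0⇒n>0 λ act≡0 → <⇒≢ 1≤x (sym (begin
    x      ≡⟨ m<n⇒m%n≡m x<n ⟨
    x % n  ≡⟨ act-injective t (trans act≡0 (sym (cong (_% n) (*-zeroʳ (a ^ t))))) ⟩
    0      ∎))
    where open ≡-Reasoning

  act-cancel : ∀ {j j' x} → j ≤ j' → x < n → act j x ≡ act j' x → act (j' ∸ j) x ≡ x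
  act-cancel {j} {j'} {x} j≤j' x<n eq = begin
    act (j' ∸ j) x          ≡⟨ m<n⇒m%n≡m (act<n (j' ∸ j) x) ⟨
    act (j' ∸ j) x % n      ≡⟨ act-injective j (trans (sym (act-+ j (j' ∸ j) x)) j'·x≡j·x) ⟩
    x % n                   ≡⟨ m<n⇒m%n≡m x<n ⟩
    x                       ∎
    where
    open ≡-Reasoning
    j'·x≡j·x : act (j + (j' ∸ j)) x ≡ act j x
    j'·x≡j·x = trans (cong (λ s → act s x) (m+[n∸m]≡n j≤j')) (sym eq)

  isMin : ℕ → Bool
  isMin = isCosetMin a m'

  isMin⇒≤act : ∀ {x} → T (isMin x) → ∀ t → x ≤ act t x
  isMin⇒≤act {x} min t = subst (x ≤_) (sym (act-%-period t x))
    (toWitness (allBelow-sound _ n min (≤-trans (m%n<n t H) H≤n)))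

  ≤act⇒isMin : ∀ {x} → (∀ t → x ≤ act t x) → T (isMin x)
  ≤act⇒isMin x≤ = allBelow-complete _ n λ {j} _ → fromWitness (x≤ j)

  isMin-≤ : ∀ {y z} i i' → T (isMin z) → y < n → act i y ≡ act i' z → z ≤ y
  isMin-≤ {y} {z} i i' min y<n eq = subst (z ≤_) (begin
    act (i * H' + i') z      ≡⟨ act-+ (i * H') i' z ⟩
    act (i * H') (act i' z)  ≡⟨ cong (act (i * H')) eq ⟨
    act (i * H') (act i y)   ≡⟨ act-inverse i y ⟩
    y % n                    ≡⟨ m<n⇒m%n≡m y<n ⟩
    y                        ∎) (isMin⇒≤act min (i * H' + i'))
    where open ≡-Reasoning

  isMin-unique : ∀ {x x'} j j' → T (isMin x) → T (isMin x') → x < n → x' < n →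
                 act j x ≡ act j' x' → x ≡ x'
  isMin-unique j j' min min' x<n x'<n eq =
    ≤-antisym (isMin-≤ j' j min x'<n (sym eq)) (isMin-≤ j j' min' x<n eq)

  leader : ∀ {y} → Within 1 m' y →
           ∃₂ λ x i → Within 1 m' x × T (isMin x) × i < H × act i x ≡ y
  leader {y} y∈@(_ , y<n) with argmin (λ i → act i y) H'
  ... | i , i<H , minimal =
    act i y , (i * H') % H , (act-nonzero i y∈ , act<n i y) , ≤act⇒isMin minimal′ ,
    m%n<n (i * H') H , returns
    where
    open ≡-Reasoning
    minimal′ : ∀ t → act i y ≤ act t (act i y)
    minimal′ t = subst (act i y ≤_) (trans (sym (act-%-period (t + i) y)) (act-+ t i y))
                       (minimal (m%n<n (t + i) H))
    returns : act ((i * H') % H) (act i y) ≡ y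
    returns = begin
      act ((i * H') % H) (act i y)  ≡⟨ act-%-period (i * H') (act i y) ⟨
      act (i * H') (act i y)        ≡⟨ act-inverse i y ⟩
      y % n                         ≡⟨ m<n⇒m%n≡m y<n ⟩
      y                             ∎

  hit : ℕ → ℕ → ℕ → ℕ
  hit x j y = indicator (isMin x) * indicator (y ≡ᵇ act j x)

  hit-pos⇒ : ∀ {x j y} → 1 ≤ hit x j y → T (isMin x) × y ≡ act j x
  hit-pos⇒ {x} {j} {y} pos with indicator-*-pos pos
  ... | min , y≡ = min , ≡ᵇ⇒≡ y (act j x) y≡

  hit-one : ∀ x j {y} → T (isMin x) → y ≡ act j x → hit x j y ≡ 1
  hit-one x j {y} min y≡ = cong₂ _*_ (indicator-T min) (indicator-T (≡⇒≡ᵇ y (act j x) y≡))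

  hit-zero : ∀ x j {y} → (T (isMin x) → y ≡ act j x → ⊥) → hit x j y ≡ 0
  hit-zero x j {y} ¬hit = n<1⇒n≡0 (≰⇒> λ pos →
    let min , y≡ = hit-pos⇒ {x} {j} {y} pos in ¬hit min y≡)

  ∑-hit : ∀ {x} j → Within 1 m' x → ∑ (hit x j) 1 m' ≡ indicator (isMin x)
  ∑-hit {x} j x∈ = begin
    ∑ (hit x j) 1 m'                   ≡⟨ ∑-*ˡ (indicator (isMin x)) _ 1 m' ⟩
    indicator (isMin x) * ∑ δ 1 m'     ≡⟨ cong (indicator (isMin x) *_) (∑-single j·x∈ δ-off) ⟩
    indicator (isMin x) * δ (act j x)  ≡⟨ cong (indicator (isMin x) *_) δ-on ⟩
    indicator (isMin x) * 1            ≡⟨ *-identityʳ _ ⟩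
    indicator (isMin x)                ∎
    where
    open ≡-Reasoning
    δ : ℕ → ℕ
    δ y = indicator (y ≡ᵇ act j x)
    j·x∈ : Within 1 m' (act j x)
    j·x∈ = act-nonzero j x∈ , act<n j x
    δ-off : ∀ y → Within 1 m' y → y ≢ act j x → δ y ≡ 0
    δ-off y _ y≢ = cong indicator (dec-false (y ≟ act j x) y≢)
    δ-on : δ (act j x) ≡ 1
    δ-on = indicator-T (≡⇒≡ᵇ (act j x) _ refl)

  hits : ℕ → ℕ → ℕ
  hits y x = ∑ (λ j → hit x j y) 0 H

  preimages : ℕ → ℕ
  preimages y = ∑ (hits y) 1 m'

  r*H≡∑preimages : r a n * H ≡ ∑ preimages 1 m'
  r*H≡∑preimages = begin
    r a n * H                                        ≡⟨ cong (_* H) (countRange≡∑ isMin 1 m') ⟩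
    ∑ (indicator ∘ isMin) 1 m' * H                   ≡⟨ *-comm _ H ⟩
    H * ∑ (indicator ∘ isMin) 1 m'                   ≡⟨ ∑-*ˡ H (indicator ∘ isMin) 1 m' ⟨
    ∑ (λ x → H * indicator (isMin x)) 1 m'           ≡⟨ ∑-cong m' (λ x x∈ → orbit-of x x∈) ⟩
    ∑ (λ x → ∑ (λ j → ∑ (hit x j) 1 m') 0 H) 1 m'    ≡⟨ ∑-cong m' (λ x _ → ∑-swap (hit x) 0 H 1 m') ⟩
    ∑ (λ x → ∑ (λ y → hits y x) 1 m') 1 m'           ≡⟨ ∑-swap (λ x y → hits y x) 1 m' 1 m' ⟩
    ∑ preimages 1 m'                                 ∎
    where
    open ≡-Reasoning
    orbit-of : ∀ x → Within 1 m' x → H * indicator (isMin x) ≡ ∑ (λ j → ∑ (hit x j) 1 m') 0 H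
    orbit-of x x∈ =
      trans (sym (∑-const (indicator (isMin x)) 0 H)) (∑-cong H λ j _ → sym (∑-hit j x∈))

  preimages-pos : ∀ {y} → Within 1 m' y → 1 ≤ preimages y
  preimages-pos {y} y∈ with leader y∈
  ... | x , i , x∈ , min , i<H , i·x≡y = begin
    1            ≡⟨ hit-one x i min (sym i·x≡y) ⟨
    hit x i y    ≤⟨ ∑-≥term (z≤n , i<H) ⟩
    hits y x     ≤⟨ ∑-≥term x∈ ⟩
    preimages y  ∎
    where open ≤-Reasoning

  fixed⇒preimages≥2 : ∀ {x j} → Within 1 m' x → 1 ≤ j → j < H → act j x ≡ x →
                      2 ≤ preimages x
  fixed⇒preimages≥2 {x} {j} x∈ 1≤j j<H fixed with leader x∈
  ... | z , i , z∈ , min , i<H , i·z≡x = begin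
    2            ≤⟨ ∑-≥2 i∈ i'∈ i≢i' (hits-x i i·z≡x) (hits-x i' i'·z≡x) ⟩
    hits x z     ≤⟨ ∑-≥term z∈ ⟩
    preimages x  ∎
    where
    open ≤-Reasoning
    i' : ℕ
    i' = (j + i) % H
    i∈ : Within 0 H i
    i∈ = z≤n , i<H
    i'∈ : Within 0 H i'
    i'∈ = z≤n , m%n<n (j + i) H
    hits-x : ∀ k → act k z ≡ x → 1 ≤ hit z k x
    hits-x k k·z≡x = ≤-reflexive (sym (hit-one z k min (sym k·z≡x)))
    i'·z≡x : act i' z ≡ x
    i'·z≡x = begin-equality
      act i' z         ≡⟨ act-%-period (j + i) z ⟨
      act (j + i) z    ≡⟨ act-+ j i z ⟩
      act j (act i z)  ≡⟨ cong (act j) i·z≡x ⟩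
      act j x          ≡⟨ fixed ⟩
      x                ∎
    i≢i' : i ≢ i'
    i≢i' i≡i' = <⇒≱ j<H (∣⇒≤ {{>-nonZero 1≤j}} ([m+n]%d≡m%d⇒d∣n i j H (begin-equality
      (i + j) % H  ≡⟨ cong (_% H) (+-comm i j) ⟩
      i'           ≡⟨ i≡i' ⟨
      i            ≡⟨ m<n⇒m%n≡m i<H ⟨
      i % H        ∎)))

  ActsFreely : Set
  ActsFreely = ∀ x j → Within 1 m' x → 1 ≤ j → j < H → act j x ≢ x

  free⇒preimages≡1 : ActsFreely → ∀ {y} → Within 1 m' y → preimages y ≡ 1
  free⇒preimages≡1 free {y} y∈ with leader y∈
  ... | x , i , x∈@(_ , x<n) , min , i<H , i·x≡y = begin
    preimages y  ≡⟨ ∑-single x∈ other-leader ⟩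
    hits y x     ≡⟨ ∑-single (z≤n , i<H) other-index ⟩
    hit x i y    ≡⟨ hit-one x i min (sym i·x≡y) ⟩
    1            ∎
    where
    open ≡-Reasoning
    other-leader : ∀ z → Within 1 m' z → z ≢ x → hits y z ≡ 0
    other-leader z (_ , z<n) z≢x = ∑-vanish H λ j _ → hit-zero z j λ min′ y≡ →
      z≢x (isMin-unique j i min′ min z<n x<n (trans (sym y≡) (sym i·x≡y)))
    no-collision : ∀ {j j'} → j < j' → j' < H → act j x ≢ act j' x
    no-collision {j} {j'} j<j' j'<H eq =
      free x (j' ∸ j) x∈ (m<n⇒0<n∸m j<j') (≤-trans (s≤s (m∸n≤m j' j)) j'<H)
           (act-cancel (<⇒≤ j<j') x<n eq)
    same-index : ∀ {j} → j < H → act j x ≡ act i x → j ≡ i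
    same-index {j} j<H eq with <-cmp j i
    ... | tri< j<i _ _ = contradiction eq (no-collision j<i i<H)
    ... | tri≈ _ j≡i _ = j≡i
    ... | tri> _ _ i<j = contradiction (sym eq) (no-collision i<j j<H)
    other-index : ∀ j → Within 0 H j → j ≢ i → hit x j y ≡ 0
    other-index j (_ , j<H) j≢i =
      hit-zero x j λ _ y≡ → j≢i (same-index j<H (trans (sym y≡) (sym i·x≡y)))

  m'≡r*H⇔free : m' ≡ r a n * H ⇔ ActsFreely
  m'≡r*H⇔free = mk⇔
    (λ m'≡r*H x j x∈ 1≤j j<H fixed → <-irrefl (trans m'≡r*H r*H≡∑preimages)
       (∑->count (λ _ → preimages-pos) x∈ (fixed⇒preimages≥2 x∈ 1≤j j<H fixed)))
    (λ free → begin
      m'                ≡⟨ *-identityʳ m' ⟨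
      m' * 1            ≡⟨ ∑-const 1 1 m' ⟨
      ∑ (λ _ → 1) 1 m'  ≡⟨ ∑-cong m' (λ _ y∈ → free⇒preimages≡1 free y∈) ⟨
      ∑ preimages 1 m'  ≡⟨ r*H≡∑preimages ⟨
      r a n * H         ∎)
    where open ≡-Reasoning

module OrderCriterion (a m' : ℕ) (1≤a : 1 ≤ a) (n⊥a : Coprime (suc m') a) {k : ℕ} (ps ls : Vec ℕ k)
                      (primes : ∀ j → Prime (lookup ps j)) (ls≥1 : ∀ j → 1 ≤ lookup ls j)
                      (n≡ : suc m' ≡ prodPow ps ls) where

  EqualOrders : ℕ → Set
  EqualOrders t = (is : Vec ℕ k) → (∀ j → lookup is j ≤ lookup ls j) →
                  ∃ (λ j → lookup is j ≢ 0) → t ≡ h a (prodPow ps is)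

  1≤a^ : ∀ t → 1 ≤ a ^ t
  1≤a^ = m^n>0 a {{>-nonZero 1≤a}}

  prime-factor-order : ∀ {t p} → EqualOrders t → Prime p → p ∣ suc m' → t ≡ h a p
  prime-factor-order {t} {p} orders≡ p-prime p∣n
    with prime∣prodPow⇒≡ ps ls primes p-prime (subst (p ∣_) n≡ p∣n)
  ... | j , p≡ = begin
    t                      ≡⟨ orders≡ unit unit≤ls (j , unit≢0) ⟩
    h a (prodPow ps unit)  ≡⟨ cong (h a) (trans (prodPow-unit ps j) (sym p≡)) ⟩
    h a p                  ∎
    where
    open ≡-Reasoning
    unit : Vec ℕ k
    unit = replicate k 0 [ j ]≔ 1
    unit≢0 : lookup unit j ≢ 0
    unit≢0 = subst (_≢ 0) (sym (lookup∘update j (replicate k 0) 1)) λ ()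
    unit≤ls : ∀ i → lookup unit i ≤ lookup ls i
    unit≤ls i with i Fin.≟ j
    ... | yes refl = subst (_≤ lookup ls i) (sym (lookup∘update i (replicate k 0) 1)) (ls≥1 i)
    ... | no  i≢j  = subst (_≤ lookup ls i) (sym unit[i]≡0) z≤n
      where
      unit[i]≡0 : lookup unit i ≡ 0
      unit[i]≡0 = trans (lookup∘update′ i≢j (replicate k 0) 1) (lookup-replicate i 0)

  module _ (H' : ℕ) (a^H≡1 : a ^ suc H' % suc m' ≡ 1 % suc m') (H≤n : suc H' ≤ suc m') where

    open Cosets a m' H' a^H≡1 H≤n

    free⇒equalOrders : ActsFreely → EqualOrders H
    free⇒equalOrders free is is≤ls nonzero = ≤-antisym H≤t t≤H
      where
      d : ℕ
      d = prodPow ps is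
      1<d : 1 < d
      1<d = prodPow>1 ps is primes nonzero
      instance
        _ : NonZero d
        _ = >-nonZero (<-trans z<s 1<d)
        _ : NonTrivial d
        _ = n>1⇒nonTrivial 1<d
      d∣n : d ∣ n
      d∣n = subst (d ∣_) (sym n≡) (prodPow-mono-∣ ps is ls is≤ls)
      t : ℕ
      t = h a d
      order : IsOrder a d t
      order = proj₁ (h-isOrder a d (coprime-∣ˡ d∣n n⊥a))
      t≤H : t ≤ H
      t≤H = least order z<s (∣-%-cong d∣n a^H≡1)
      q : ℕ
      q = quotient d∣n
      q∈ : Within 1 m' q
      q∈ = >-nonZero⁻¹ q {{quotient≢0 d∣n}} , quotient-< d∣n
      n∣[a^t∸1]*q : n ∣ (a ^ t ∸ 1) * q
      n∣[a^t∸1]*q = subst (_∣ (a ^ t ∸ 1) * q) (sym (m∣n⇒n≡m*quotient d∣n))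
                          (*-monoˡ-∣ q (to (b%d≡1%d⇔d∣b∸1 d (1≤a^ t)) (holds order)))
      q-fixed : act t q ≡ q
      q-fixed = trans (from ([b*x]%d≡x%d⇔d∣[b∸1]*x q n (1≤a^ t)) n∣[a^t∸1]*q)
                      (m<n⇒m%n≡m (proj₂ q∈))
      H≤t : H ≤ t
      H≤t = ≮⇒≥ λ t<H → free q t q∈ (lowerBound order) t<H q-fixed

    equalOrders⇒free : EqualOrders H → ActsFreely
    equalOrders⇒free orders≡ x j (1≤x , x<n) 1≤j j<H fixed
      with common-prime-divisor {n} {a ^ j ∸ 1} ¬n⊥a^j∸1
      where
      n∣[a^j∸1]*x : n ∣ (a ^ j ∸ 1) * x
      n∣[a^j∸1]*x =
        to ([b*x]%d≡x%d⇔d∣[b∸1]*x x n (1≤a^ j)) (trans fixed (sym (m<n⇒m%n≡m x<n)))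
      ¬n⊥a^j∸1 : ¬ Coprime n (a ^ j ∸ 1)
      ¬n⊥a^j∸1 n⊥ = <⇒≱ x<n (∣⇒≤ {{>-nonZero 1≤x}} (coprime-divisor n⊥ n∣[a^j∸1]*x))
    ... | p , p-prime , p∣n , p∣a^j∸1 = <⇒≱ j<H (subst (_≤ j) (sym H≡h[p]) h[p]≤j)
      where
      instance
        _ : NonZero p
        _ = prime⇒nonZero p-prime
      H≡h[p] : H ≡ h a p
      H≡h[p] = prime-factor-order orders≡ p-prime p∣n
      h[p]≤j : h a p ≤ j
      h[p]≤j = least (proj₁ (h-isOrder a p (coprime-∣ˡ p∣n n⊥a))) 1≤j
                     (from (b%d≡1%d⇔d∣b∸1 p (1≤a^ j)) p∣a^j∸1)

  order-criterion : ∀ t → 1 ≤ t → t ≤ suc m' → a ^ t % suc m' ≡ 1 % suc m' →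
                    suc m' ≡ r a (suc m') * t + 1 ⇔ EqualOrders t
  order-criterion (suc H') _ H≤n a^H≡1 = mk⇔
    (λ n≡r*H+1 → free⇒equalOrders H' a^H≡1 H≤n
                   (to m'≡r*H⇔free (suc-injective (trans n≡r*H+1 (+-comm _ 1)))))
    (λ orders≡ → trans (cong suc (from m'≡r*H⇔free (equalOrders⇒free H' a^H≡1 H≤n orders≡)))
                       (+-comm 1 _))
    where open Cosets a m' H' a^H≡1 H≤n using (m'≡r*H⇔free)

theorem7 : (a n : ℕ) → 1 < a → Odd n → Composite n → gcd n a ≡ 1 →
    (k : ℕ) (ps ls : Vec ℕ k) →
    (∀ j → Prime (lookup ps j)) →
    (∀ j j′ → lookup ps j ≡ lookup ps j′ → j ≡ j′) →
    (∀ j → 1 ≤ lookup ls j) →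
    n ≡ prodPow ps ls →
    (Overpseudoprime a n ⇔
      ((is : Vec ℕ k) → (∀ j → lookup is j ≤ lookup ls j) →
        ∃ (λ j → lookup is j ≢ 0) →
        h a n ≡ h a (prodPow ps is)))
theorem7 a zero _ () _ _ _ _ _ _ _ _ _
-- The criterion does not need the primes to be distinct.
theorem7 a (suc m') 1<a odd composite gcd≡1 k ps ls primes _ ls≥1 n≡ =
  mk⇔ (λ (_ , _ , _ , n≡r*h+1) → to criterion n≡r*h+1)
      (λ orders≡ → odd , composite , gcd≡1 , from criterion orders≡)
  where
  n⊥a : Coprime (suc m') a
  n⊥a = gcd≡1⇒coprime gcd≡1
  open OrderCriterion a m' (<⇒≤ 1<a) n⊥a ps ls primes ls≥1 n≡
  order : IsOrder a (suc m') (h a (suc m')) × h a (suc m') ≤ suc m'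
  order = h-isOrder a (suc m') n⊥a
  criterion : suc m' ≡ r a (suc m') * h a (suc m') + 1 ⇔ EqualOrders (h a (suc m'))
  criterion = order-criterion (h a (suc m')) (lowerBound (proj₁ order)) (proj₂ order)
                              (holds (proj₁ order))
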